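{- Let $G$ be a graph of maximum degree $\Delta$ with an almost-clique decomposition for $\varepsilon=1/172$, and let $q(n)=10\log^3\log n$. Any node $v$ in an ordinary almost-clique $C$ has at least $e_C\cdot(\Delta-3e_C)$ non-edges in its neighborhood (i.e., unordered pairs of non-adjacent nodes in $N(v)$). In particular, any node in a small ordinary almost-clique has at least $\Delta^2/(2q(n))$ non-edges in its neighborhood.
   Context: $N(v)$ is the neighbor set of $v$. An almost-clique decomposition (ACD) with parameter $\varepsilon$ partitions the node set into $V_{sparse}$ and disjoint sets $C_1,\dots,C_t$ (almost-cliques, ACs) with $(1-\varepsilon/4)\Delta\le|C_i|\le(1+\varepsilon)\Delta$, every $v\in C_i$ having at least $(1-\varepsilon)\Delta$ neighbors in $C_i$, and every $u\notin C_i$ having at most $(1-\varepsilon/2)\Delta$ neighbors in $C_i$. For an AC $C$ let $e_C=\Delta-|C|+1$. An AC is easy if it contains two non-adjacent nodes or a node of degree less than $\Delta$. A node $v\notin C$ is an intrusive neighbor of a non-easy AC $C$ if $v$ has at least $2e_C$ neighbors in $C$. A non-easy AC is difficult if it has an intrusive neighbor; each difficult AC $C$ selects one intrusive neighbor as its special node $s_C$. An AC is nice if it is easy, or if it is not difficult and contains the special node of some AC; it is ordinary if it is neither nice nor difficult. An ordinary AC is large if it contains more than $\Delta-\Delta/q(n)$ nodes, and small otherwise. -}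

module Defs where

open import Data.Nat using (ℕ; zero; suc; _+_; _*_; _∸_; _≤_; _<_)
open import Data.Bool using (Bool; true; false; if_then_else_; _∧_; not)
open import Data.Fin using (Fin) renaming (zero to fzero; suc to fsuc)
import Data.Fin as F
open import Data.Maybe using (Maybe; just; nothing)
open import Data.Product using (Σ; ∃; ∃-syntax; _×_; _,_)
open import Data.Sum using (_⊎_)
open import Relation.Nullary using (¬_)
open import Relation.Nullary.Decidable using (⌊_⌋)
open import Relation.Binary.PropositionalEquality using (_≡_)

sumF : ∀ {n} → (Fin n → ℕ) → ℕ
sumF {zero}  f = 0
sumF {suc n} f = f fzero + sumF (λ i → f (fsuc i))

count : ∀ {n} → (Fin n → Bool) → ℕ
count f = sumF (λ i → if f i then 1 else 0)

record Graph (n : ℕ) : Set where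
  field
    adj    : Fin n → Fin n → Bool
    sym    : ∀ u v → adj u v ≡ adj v u
    irrefl : ∀ v → adj v v ≡ false
open Graph public

deg : ∀ {n} → Graph n → Fin n → ℕ
deg G v = count (adj G v)

MaxDegree : ∀ {n} → Graph n → ℕ → Set
MaxDegree {n} G Δ = (∀ v → deg G v ≤ Δ) × (∀ (v : Fin n) → ∃[ u ] deg G u ≡ Δ)

-- number of unordered pairs {u,w} ⊆ N(v) of non-adjacent nodes
-- (each unordered pair counted once, as the ordered pair with u < w)
nonEdgesNbhd : ∀ {n} → Graph n → Fin n → ℕ
nonEdgesNbhd G v =
  sumF (λ u → count (λ w → ⌊ u F.<? w ⌋ ∧ adj G v u ∧ adj G v w ∧ not (adj G u w)))

-- A decomposition into V_sparse and
-- disjoint sets C_0,…,C_{t-1} is given by a map  part : Fin n → Maybe (Fin t)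
-- (part v ≡ nothing  ⇔  v ∈ V_sparse,  part v ≡ just i  ⇔  v ∈ C_i).

module _ {n t : ℕ} (G : Graph n) (Δ : ℕ) (part : Fin n → Maybe (Fin t)) where

  inAC : Fin t → Fin n → Bool
  inAC i v with part v
  ... | nothing = false
  ... | just j  = ⌊ j F.≟ i ⌋

  _∈AC_ : Fin n → Fin t → Set
  v ∈AC i = inAC i v ≡ true

  size : Fin t → ℕ
  size i = count (inAC i)

  degIn : Fin t → Fin n → ℕ
  degIn i u = count (λ w → adj G u w ∧ inAC i w)

  -- ACD with parameter ε = 1/k (all inequalities multiplied by 4k)
  --   (1 - ε/4)Δ ≤ |C_i| ≤ (1 + ε)Δ
  --   v ∈ C_i  ⇒  |N(v) ∩ C_i| ≥ (1 - ε)Δ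
  --   u ∉ C_i  ⇒  |N(u) ∩ C_i| ≤ (1 - ε/2)Δ
  IsACD : ℕ → Set
  IsACD k = ∀ i →
      ((4 * k ∸ 1) * Δ ≤ 4 * k * size i)
    × (k * size i ≤ (k + 1) * Δ)
    × (∀ v → v ∈AC i → (k ∸ 1) * Δ ≤ k * degIn i v)
    × (∀ u → ¬ (u ∈AC i) → 2 * k * degIn i u ≤ (2 * k ∸ 1) * Δ)

  -- e_C = Δ - |C| + 1  (only used for non-easy ACs, where |C| ≤ Δ + 1)
  eAC : Fin t → ℕ
  eAC i = (Δ + 1) ∸ size i

  Easy : Fin t → Set
  Easy i = (∃[ u ] ∃[ w ] (u ∈AC i × w ∈AC i × ¬ (u ≡ w) × adj G u w ≡ false))
         ⊎ (∃[ v ] (v ∈AC i × deg G v < Δ))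

  IntrusiveNeighbor : Fin t → Fin n → Set
  IntrusiveNeighbor i v = ¬ Easy i × ¬ (v ∈AC i) × (2 * eAC i ≤ degIn i v)

  Difficult : Fin t → Set
  Difficult i = ¬ Easy i × ∃[ v ] IntrusiveNeighbor i v

  SpecialSelection : (Fin t → Fin n) → Set
  SpecialSelection s = ∀ i → Difficult i → IntrusiveNeighbor i (s i)

  module _ (s : Fin t → Fin n) where

    Nice : Fin t → Set
    Nice i = Easy i ⊎ (¬ Difficult i × ∃[ j ] (Difficult j × s j ∈AC i))

    Ordinary : Fin t → Set
    Ordinary i = ¬ Nice i × ¬ Difficult i

  -- C_i is small w.r.t. the threshold q = a / b  (a, b > 0):
  --   |C_i| ≤ Δ - Δ/q   ⇔   a·|C_i| + b·Δ ≤ a·Δ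
  Small : ℕ → ℕ → Fin t → Set
  Small a b i = a * size i + b * Δ ≤ a * Δ

-- Since C is not easy, it is a clique of Δ + 1 − e nodes of degree Δ, so a node v ∈ C has
-- exactly e neighbours outside C.  As C is not difficult, each such neighbour u is adjacent
-- to fewer than 2e nodes of C, so u is non-adjacent to at least Δ − 3e of the Δ − e
-- neighbours of v inside C; these pairs {u, x} are distinct non-edges in N(v).  If C is
-- small then e > Δ/q, and the ACD bound |C| ≥ (1 − ε/4)Δ gives 6e ≤ Δ, so
-- e(Δ − 3e) ≥ eΔ/2 ≥ Δ²/(2q).
module Submission where

open import Defs
open import Data.Bool using (Bool; true; false; if_then_else_; _∧_; not)
open import Data.Bool.Properties using (∧-comm; ∧-conicalˡ; ∧-conicalʳ)
open import Data.Empty using (⊥-elim)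
open import Data.Fin using (Fin) renaming (zero to fzero; suc to fsuc)
import Data.Fin as F
import Data.Fin.Properties as Finₚ
open import Data.Maybe using (Maybe)
open import Data.Nat using (ℕ; zero; suc; _+_; _*_; _∸_; _≤_; _<_; z≤n; s≤s)
open import Data.Nat.Properties
open import Algebra.Properties.CommutativeSemigroup +-commutativeSemigroup
  using () renaming (interchange to +-interchange)
open import Data.Nat.Tactic.RingSolver using (solve-∀)
open import Data.Product using (_×_; _,_; proj₁)
open import Data.Sum using (inj₁; inj₂)
open import Function using (_∘_; case_of_)
open import Relation.Binary.PropositionalEquality as ≡ using (_≡_; refl; cong; cong₂; subst; subst₂)
open import Relation.Nullary using (¬_; yes; no)
open import Relation.Nullary.Decidable using (⌊_⌋)

sumF-cong : ∀ {n} {f g : Fin n → ℕ} → (∀ i → f i ≡ g i) → sumF f ≡ sumF g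
sumF-cong {zero}  f≗g = refl
sumF-cong {suc n} f≗g = cong₂ _+_ (f≗g fzero) (sumF-cong (f≗g ∘ fsuc))

sumF-mono : ∀ {n} {f g : Fin n → ℕ} → (∀ i → f i ≤ g i) → sumF f ≤ sumF g
sumF-mono {zero}  f≤g = z≤n
sumF-mono {suc n} f≤g = +-mono-≤ (f≤g fzero) (sumF-mono (f≤g ∘ fsuc))

sumF-zero : ∀ n → sumF {n} (λ _ → 0) ≡ 0
sumF-zero zero    = refl
sumF-zero (suc n) = sumF-zero n

sumF-+ : ∀ {n} (f g : Fin n → ℕ) → sumF (λ i → f i + g i) ≡ sumF f + sumF g
sumF-+ {zero}  f g = refl
sumF-+ {suc n} f g = ≡.trans (cong (f fzero + g fzero +_) (sumF-+ (f ∘ fsuc) (g ∘ fsuc)))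
  (+-interchange (f fzero) (g fzero) (sumF (f ∘ fsuc)) (sumF (g ∘ fsuc)))

*-distribˡ-sumF : ∀ {n} c (f : Fin n → ℕ) → c * sumF f ≡ sumF (λ i → c * f i)
*-distribˡ-sumF {zero}  c f = *-zeroʳ c
*-distribˡ-sumF {suc n} c f = ≡.trans (*-distribˡ-+ c (f fzero) (sumF (f ∘ fsuc)))
  (cong (c * f fzero +_) (*-distribˡ-sumF c (f ∘ fsuc)))

sumF-comm : ∀ {m n} (h : Fin m → Fin n → ℕ) →
  sumF (λ i → sumF (h i)) ≡ sumF (λ j → sumF (λ i → h i j))
sumF-comm {zero}  {n} h = ≡.sym (sumF-zero n)
sumF-comm {suc m} h = ≡.trans (cong (sumF (h fzero) +_) (sumF-comm (h ∘ fsuc)))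
  (≡.sym (sumF-+ (h fzero) (λ j → sumF (λ i → h (fsuc i) j))))

f≤sumF : ∀ {n} (f : Fin n → ℕ) j → f j ≤ sumF f
f≤sumF f fzero    = m≤m+n _ _
f≤sumF f (fsuc j) = ≤-trans (f≤sumF (f ∘ fsuc) j) (m≤n+m _ _)

sumF² : ∀ {n} → (Fin n → Fin n → ℕ) → ℕ
sumF² h = sumF (λ i → sumF (h i))

sumF²-symmetrise : ∀ {n} (h : Fin n → Fin n → ℕ) →
  sumF² (λ i j → h i j + h j i) ≡ sumF² h + sumF² h
sumF²-symmetrise h = ≡.trans (sumF-cong (λ i → sumF-+ (h i) (λ j → h j i)))
  (≡.trans (sumF-+ (λ i → sumF (h i)) (λ i → sumF (λ j → h j i)))
           (cong (sumF² h +_) (≡.sym (sumF-comm h))))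

m+m≤n+n⇒m≤n : ∀ {m n} → m + m ≤ n + n → m ≤ n
m+m≤n+n⇒m≤n {m} {n} le with m ≤? n
... | yes m≤n = m≤n
... | no  m≰n = ⊥-elim (<⇒≱ (+-mono-< (≰⇒> m≰n) (≰⇒> m≰n)) le)

sumF²-mono-sym : ∀ {n} {h k : Fin n → Fin n → ℕ} →
  (∀ i j → h i j + h j i ≤ k i j + k j i) → sumF² h ≤ sumF² k
sumF²-mono-sym {h = h} {k} le = m+m≤n+n⇒m≤n
  (subst₂ _≤_ (sumF²-symmetrise h) (sumF²-symmetrise k) (sumF-mono (λ i → sumF-mono (le i))))

𝟙 : Bool → ℕ
𝟙 b = if b then 1 else 0

𝟙≤1 : ∀ b → 𝟙 b ≤ 1
𝟙≤1 true  = ≤-refl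
𝟙≤1 false = z≤n

count-cong : ∀ {n} {f g : Fin n → Bool} → (∀ i → f i ≡ g i) → count f ≡ count g
count-cong f≗g = sumF-cong (cong 𝟙 ∘ f≗g)

count-mono : ∀ {n} {f g : Fin n → Bool} → (∀ i → f i ≡ true → g i ≡ true) → count f ≤ count g
count-mono {f = f} {g} f⊆g = sumF-mono 𝟙-mono
  where
  𝟙-mono : ∀ i → 𝟙 (f i) ≤ 𝟙 (g i)
  𝟙-mono i with f i in fi
  ... | false = z≤n
  ... | true rewrite f⊆g i fi = ≤-refl

count-split : ∀ {n} (f g : Fin n → Bool) →
  count f ≡ count (λ i → f i ∧ g i) + count (λ i → f i ∧ not (g i))
count-split f g =
  ≡.trans (sumF-cong 𝟙-split) (sumF-+ (λ i → 𝟙 (f i ∧ g i)) (λ i → 𝟙 (f i ∧ not (g i))))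
  where
  𝟙-split : ∀ i → 𝟙 (f i) ≡ 𝟙 (f i ∧ g i) + 𝟙 (f i ∧ not (g i))
  𝟙-split i with f i | g i
  ... | false | _     = refl
  ... | true  | true  = refl
  ... | true  | false = refl

count-pos : ∀ {n} (f : Fin n → Bool) {j} → f j ≡ true → 1 ≤ count f
count-pos f {j} fj = subst (λ b → 𝟙 b ≤ count f) fj (f≤sumF (𝟙 ∘ f) j)

count-≤1 : ∀ {n} (f : Fin n → Bool) (j : Fin n) → (∀ i → f i ≡ true → i ≡ j) → count f ≤ 1
count-≤1 {suc n} f fzero f⊆j = +-mono-≤ (𝟙≤1 (f fzero)) tail≤0
  where
  tail≤0 : count (f ∘ fsuc) ≤ 0
  tail≤0 = subst (count (f ∘ fsuc) ≤_) (sumF-zero n)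
    (count-mono {g = λ _ → false} (λ i e → ⊥-elim (Finₚ.0≢1+n (≡.sym (f⊆j (fsuc i) e)))))
count-≤1 {suc n} f (fsuc j) f⊆j with f fzero in f0
... | true  = ⊥-elim (Finₚ.0≢1+n (f⊆j fzero f0))
... | false = count-≤1 (f ∘ fsuc) j (λ i e → Finₚ.suc-injective (f⊆j (fsuc i) e))

*-count≤sumF : ∀ {n} (p : Fin n → Bool) (g : Fin n → ℕ) c →
  (∀ i → p i ≡ true → c ≤ g i) → c * count p ≤ sumF g
*-count≤sumF p g c bound = subst (_≤ sumF g) (≡.sym (*-distribˡ-sumF c (𝟙 ∘ p))) (sumF-mono termwise)
  where
  termwise : ∀ i → c * 𝟙 (p i) ≤ g i
  termwise i with p i in pi
  ... | false rewrite *-zeroʳ c     = z≤n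
  ... | true  rewrite *-identityʳ c = bound i pi

not≡true⇒≡false : ∀ {b} → not b ≡ true → b ≡ false
not≡true⇒≡false {false} _ = refl

countPairs : ∀ {n} → (Fin n → Fin n → Bool) → ℕ
countPairs r = sumF² (λ u w → 𝟙 (r u w))

countPairs-asym≤ : ∀ {n} {m R : Fin n → Fin n → Bool} →
  (∀ u w → R u w ≡ R w u) → (∀ u w → m u w ≡ true → R u w ≡ true) →
  (∀ u w → m u w ≡ true → m w u ≡ false) →
  countPairs m ≤ countPairs (λ u w → ⌊ u F.<? w ⌋ ∧ R u w)
countPairs-asym≤ {n} {m} {R} R-sym m⊆R m-asym = sumF²-mono-sym pairwise
  where
  R< : Fin n → Fin n → Bool
  R< u w = ⌊ u F.<? w ⌋ ∧ R u w

  covered : ∀ u w → m u w ≡ true → 1 ≤ 𝟙 (R< u w) + 𝟙 (R< w u)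
  covered u w muw with u F.<? w | w F.<? u
  ... | yes _ | _     rewrite m⊆R u w muw = s≤s z≤n
  ... | no _  | yes _ rewrite R-sym w u | m⊆R u w muw = s≤s z≤n
  ... | no u≮w | no w≮u with Finₚ.≤-antisym (≮⇒≥ w≮u) (≮⇒≥ u≮w)
  ...   | refl = case ≡.trans (≡.sym muw) (m-asym u u muw) of λ ()

  pairwise : ∀ u w → 𝟙 (m u w) + 𝟙 (m w u) ≤ 𝟙 (R< u w) + 𝟙 (R< w u)
  pairwise u w with m u w in muw | m w u in mwu
  ... | false | false = z≤n
  ... | true  | false = covered u w muw
  ... | false | true  = subst (1 ≤_) (+-comm (𝟙 (R< w u)) _) (covered w u mwu)
  ... | true  | true  = case ≡.trans (≡.sym mwu) (m-asym u w muw) of λ ()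

module _ {n} (G : Graph n) (v : Fin n) where

  nbrNonEdge : Fin n → Fin n → Bool
  nbrNonEdge u w = adj G v u ∧ adj G v w ∧ not (adj G u w)

  nbrNonEdge-sym : ∀ u w → nbrNonEdge u w ≡ nbrNonEdge w u
  nbrNonEdge-sym u w rewrite Graph.sym G u w with adj G v u | adj G v w
  ... | false | false = refl
  ... | false | true  = refl
  ... | true  | false = refl
  ... | true  | true  = refl

  module _ (inC : Fin n → Bool) where

    insideNeighbour outsideNeighbour : Fin n → Bool
    insideNeighbour  x = adj G v x ∧ inC x
    outsideNeighbour u = adj G v u ∧ not (inC u)

    crossNonEdge : Fin n → Fin n → Bool
    crossNonEdge u x = outsideNeighbour u ∧ insideNeighbour x ∧ not (adj G u x)

    crossNonEdge-true : ∀ u x → crossNonEdge u x ≡ true →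
      adj G v u ≡ true × inC u ≡ false × adj G v x ≡ true × inC x ≡ true × adj G u x ≡ false
    crossNonEdge-true u x with adj G v u | inC u | adj G v x | inC x | adj G u x
    ... | false | _     | _     | _     | _     = λ ()
    ... | true  | true  | _     | _     | _     = λ ()
    ... | true  | false | false | _     | _     = λ ()
    ... | true  | false | true  | false | _     = λ ()
    ... | true  | false | true  | true  | true  = λ ()
    ... | true  | false | true  | true  | false = λ _ → refl , refl , refl , refl , refl

    crossNonEdges≤nonEdgesNbhd : countPairs crossNonEdge ≤ nonEdgesNbhd G v
    crossNonEdges≤nonEdgesNbhd = countPairs-asym≤ nbrNonEdge-sym cross⊆nbrNonEdge cross-asym
      where
      cross⊆nbrNonEdge : ∀ u x → crossNonEdge u x ≡ true → nbrNonEdge u x ≡ true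
      cross⊆nbrNonEdge u x cross with crossNonEdge-true u x cross
      ... | vu , _ , vx , _ , ux rewrite vu | vx | ux = refl

      cross-asym : ∀ u x → crossNonEdge u x ≡ true → crossNonEdge x u ≡ false
      cross-asym u x cross with crossNonEdge x u in cross′
      ... | false = refl
      ... | true with crossNonEdge-true u x cross | crossNonEdge-true x u cross′
      ...   | _ , _ , _ , x∈C , _ | _ , x∉C , _ = case ≡.trans (≡.sym x∈C) x∉C of λ ()

    -- Each outside neighbour u with at most d neighbours in C misses at least
    -- |N(v) ∩ C| − d of the inside neighbours.
    nonEdgesNbhd-≥ : ∀ d → (∀ u → inC u ≡ false → count (λ w → adj G u w ∧ inC w) ≤ d) →
      count outsideNeighbour * (count insideNeighbour ∸ d) ≤ nonEdgesNbhd G v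
    nonEdgesNbhd-≥ d few = ≤-trans
      (subst (_≤ countPairs crossNonEdge) (*-comm (count insideNeighbour ∸ d) _)
        (*-count≤sumF outsideNeighbour (count ∘ crossNonEdge) _ row))
      crossNonEdges≤nonEdgesNbhd
      where
      row : ∀ u → outsideNeighbour u ≡ true → count insideNeighbour ∸ d ≤ count (crossNonEdge u)
      row u out rewrite out = m≤n+o⇒m∸n≤o _ d (begin
        count insideNeighbour
          ≡⟨ count-split insideNeighbour (adj G u) ⟩
        count (λ x → insideNeighbour x ∧ adj G u x) + count (λ x → insideNeighbour x ∧ not (adj G u x))
          ≤⟨ +-monoˡ-≤ _ (≤-trans (count-mono common) (few u u∉C)) ⟩
        d + count (λ x → insideNeighbour x ∧ not (adj G u x)) ∎)
        where
        open ≤-Reasoning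
        u∉C : inC u ≡ false
        u∉C = not≡true⇒≡false (∧-conicalʳ (adj G v u) _ out)
        common : ∀ x → insideNeighbour x ∧ adj G u x ≡ true → adj G u x ∧ inC x ≡ true
        common x e = cong₂ _∧_ (∧-conicalʳ (insideNeighbour x) _ e)
          (∧-conicalʳ (adj G v x) _ (∧-conicalˡ _ (adj G u x) e))

    module _ (v∈C : inC v ≡ true) (clique : ∀ x → inC x ≡ true → adj G v x ≡ false → x ≡ v) where

      count≡insideNeighbours+1 : count inC ≡ count insideNeighbour + 1
      count≡insideNeighbours+1 = ≡.trans (count-split inC (adj G v))
        (cong₂ _+_ (count-cong (λ x → ∧-comm (inC x) (adj G v x)))
                   (≤-antisym (count-≤1 nonNeighbour v onlyV) (count-pos nonNeighbour vNonNeighbour)))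
        where
        nonNeighbour : Fin n → Bool
        nonNeighbour x = inC x ∧ not (adj G v x)
        onlyV : ∀ x → nonNeighbour x ≡ true → x ≡ v
        onlyV x e = clique x (∧-conicalˡ _ (not (adj G v x)) e)
                             (not≡true⇒≡false (∧-conicalʳ (inC x) _ e))
        vNonNeighbour : nonNeighbour v ≡ true
        vNonNeighbour = cong₂ _∧_ v∈C (cong not (irrefl G v))

      nonEdgesNbhd-≥-clique : ∀ Δ → deg G v ≡ Δ → let e = (Δ + 1) ∸ count inC in
        (∀ u → inC u ≡ false → count (λ w → adj G u w ∧ inC w) ≤ 2 * e) →
        e * (Δ ∸ 3 * e) ≤ nonEdgesNbhd G v
      nonEdgesNbhd-≥-clique Δ deg≡Δ few = begin
        e * (Δ ∸ 3 * e)       ≡⟨ cong₂ (λ k δ → k * (δ ∸ 3 * k)) e≡K Δ≡A+K ⟩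
        K * (A + K ∸ 3 * K)   ≡⟨ cong (K *_) (≡.trans (cong (_∸ 3 * K) (+-comm A K))
                                                      ([m+n]∸[m+o]≡n∸o K A (2 * K))) ⟩
        K * (A ∸ 2 * K)       ≤⟨ nonEdgesNbhd-≥ (2 * K) few′ ⟩
        nonEdgesNbhd G v      ∎
        where
        open ≤-Reasoning
        A K e : ℕ
        A = count insideNeighbour
        K = count outsideNeighbour
        e = (Δ + 1) ∸ count inC

        Δ≡A+K : Δ ≡ A + K
        Δ≡A+K = ≡.trans (≡.sym deg≡Δ) (count-split (adj G v) inC)

        e≡K : e ≡ K
        e≡K = begin-equality
          (Δ + 1) ∸ count inC   ≡⟨ cong₂ (λ δ c → (δ + 1) ∸ c) Δ≡A+K count≡insideNeighbours+1 ⟩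
          (A + K + 1) ∸ (A + 1) ≡⟨ cong (_∸ (A + 1)) (+-assoc A K 1) ⟩
          (A + (K + 1)) ∸ (A + 1) ≡⟨ [m+n]∸[m+o]≡n∸o A (K + 1) 1 ⟩
          (K + 1) ∸ 1           ≡⟨ m+n∸n≡m K 1 ⟩
          K                     ∎

        few′ : ∀ u → inC u ≡ false → count (λ w → adj G u w ∧ inC w) ≤ 2 * K
        few′ u u∉C = subst (λ k → _ ≤ 2 * k) e≡K (few u u∉C)

m*n≤[1+m]*o⇒m*[n∸o]≤o : ∀ m n o → m * n ≤ suc m * o → m * (n ∸ o) ≤ o
m*n≤[1+m]*o⇒m*[n∸o]≤o m n o le = begin
  m * (n ∸ o)       ≡⟨ *-distribˡ-∸ m n o ⟩
  m * n ∸ m * o     ≤⟨ ∸-monoˡ-≤ (m * o) le ⟩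
  suc m * o ∸ m * o ≡⟨ m+n∸n≡m o (m * o) ⟩
  o                 ∎
  where open ≤-Reasoning

n≤2*[n∸3e] : ∀ n e → 6 * e ≤ n → n ≤ 2 * (n ∸ 3 * e)
n≤2*[n∸3e] n e 6e≤n = begin
  n                   ≤⟨ m+n≤o⇒m≤o∸n n (+-monoʳ-≤ n 6e≤n) ⟩
  n + n ∸ 6 * e       ≡⟨ cong₂ _∸_ (cong (n +_) (≡.sym (+-identityʳ n))) (*-assoc 2 3 e) ⟩
  2 * n ∸ 2 * (3 * e) ≡⟨ ≡.sym (*-distribˡ-∸ 2 n (3 * e)) ⟩
  2 * (n ∸ 3 * e)     ∎
  where open ≤-Reasoning

m*[n*o]≡n*[m*o] : ∀ m n o → m * (n * o) ≡ n * (m * o)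
m*[n*o]≡n*[m*o] = solve-∀

-- 11 (Δ − S) ≤ S forces 6e ≤ Δ once S < Δ; the case Δ ∸ S = 0 is trivial.
gap*Δ≤2*e*[Δ∸3e] : ∀ Δ S → 11 * (Δ ∸ S) ≤ S → let e = (Δ + 1) ∸ S in
  (Δ ∸ S) * Δ ≤ 2 * (e * (Δ ∸ 3 * e))
gap*Δ≤2*e*[Δ∸3e] Δ S 11k≤S with Δ ∸ S in k≡
... | zero  = z≤n
... | suc j = begin
  suc j * Δ                 ≤⟨ *-monoˡ-≤ Δ (m≤m+n (suc j) 1) ⟩
  e * Δ                     ≤⟨ *-monoʳ-≤ e (n≤2*[n∸3e] Δ e 6e≤Δ) ⟩
  e * (2 * (Δ ∸ 3 * e))     ≡⟨ m*[n*o]≡n*[m*o] e 2 (Δ ∸ 3 * e) ⟩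
  2 * (e * (Δ ∸ 3 * e))     ≡⟨ cong (λ e′ → 2 * (e′ * (Δ ∸ 3 * e′))) (≡.sym e≡k+1) ⟩
  2 * (((Δ + 1) ∸ S) * (Δ ∸ 3 * ((Δ + 1) ∸ S))) ∎
  where
  open ≤-Reasoning
  e : ℕ
  e = suc j + 1

  S≤Δ : S ≤ Δ
  S≤Δ = <⇒≤ (m∸n≢0⇒n<m (λ k≡0 → case ≡.trans (≡.sym k≡) k≡0 of λ ()))

  e≡k+1 : (Δ + 1) ∸ S ≡ e
  e≡k+1 = ≡.trans (+-∸-comm 1 S≤Δ) (cong (_+ 1) k≡)

  6[k+1]≡6k+6 : ∀ k → 6 * (k + 1) ≡ 6 * k + 6
  6[k+1]≡6k+6 = solve-∀
  6k+6k≡11k+k : ∀ k → 6 * k + 6 * k ≡ 11 * k + k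
  6k+6k≡11k+k = solve-∀

  6e≤Δ : 6 * e ≤ Δ
  6e≤Δ = begin
    6 * (suc j + 1)          ≡⟨ 6[k+1]≡6k+6 (suc j) ⟩
    6 * suc j + 6            ≤⟨ +-monoʳ-≤ (6 * suc j) (*-monoʳ-≤ 6 (s≤s z≤n)) ⟩
    6 * suc j + 6 * suc j    ≡⟨ 6k+6k≡11k+k (suc j) ⟩
    11 * suc j + suc j       ≤⟨ +-monoˡ-≤ (suc j) 11k≤S ⟩
    S + suc j                ≡⟨ ≡.trans (cong (S +_) (≡.sym k≡)) (m+[n∸m]≡n S≤Δ) ⟩
    Δ                        ∎

small⇒b*Δ²≤2*a*N : ∀ a b Δ S N → a * S + b * Δ ≤ a * Δ → 11 * (Δ ∸ S) ≤ S →
  let e = (Δ + 1) ∸ S in e * (Δ ∸ 3 * e) ≤ N → b * (Δ * Δ) ≤ 2 * a * N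
small⇒b*Δ²≤2*a*N a b Δ S N small 11k≤S bound = begin
  b * (Δ * Δ)                ≡⟨ ≡.sym (*-assoc b Δ Δ) ⟩
  b * Δ * Δ                  ≤⟨ *-monoˡ-≤ Δ bΔ≤a[Δ∸S] ⟩
  a * (Δ ∸ S) * Δ            ≡⟨ *-assoc a (Δ ∸ S) Δ ⟩
  a * ((Δ ∸ S) * Δ)          ≤⟨ *-monoʳ-≤ a (gap*Δ≤2*e*[Δ∸3e] Δ S 11k≤S) ⟩
  a * (2 * (e * (Δ ∸ 3 * e))) ≤⟨ *-monoʳ-≤ a (*-monoʳ-≤ 2 bound) ⟩
  a * (2 * N)                ≡⟨ m*[n*o]≡n*[m*o] a 2 N ⟩
  2 * (a * N)                ≡⟨ ≡.sym (*-assoc 2 a N) ⟩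
  2 * a * N                  ∎
  where
  open ≤-Reasoning
  e : ℕ
  e = (Δ + 1) ∸ S
  bΔ≤a[Δ∸S] : b * Δ ≤ a * (Δ ∸ S)
  bΔ≤a[Δ∸S] = subst (b * Δ ≤_) (≡.sym (*-distribˡ-∸ a Δ S))
    (m+n≤o⇒m≤o∸n (b * Δ) (subst (_≤ a * Δ) (+-comm (a * S) (b * Δ)) small))

module _ {n t} (G : Graph n) (Δ : ℕ) (part : Fin n → Maybe (Fin t)) (C : Fin t)
         (¬easy : ¬ Easy G Δ part C) where

  ¬easy⇒deg≡Δ : MaxDegree G Δ → ∀ {v} → _∈AC_ G Δ part v C → deg G v ≡ Δ
  ¬easy⇒deg≡Δ (deg≤Δ , _) {v} v∈C =
    ≤-antisym (deg≤Δ v) (≮⇒≥ (λ deg<Δ → ¬easy (inj₂ (v , v∈C , deg<Δ))))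

  ¬easy⇒clique : ∀ {v} → _∈AC_ G Δ part v C →
    ∀ x → _∈AC_ G Δ part x C → adj G v x ≡ false → x ≡ v
  ¬easy⇒clique {v} v∈C x x∈C nonadjacent with x F.≟ v
  ... | yes x≡v = x≡v
  ... | no  x≢v = ⊥-elim (¬easy (inj₁ (v , x , v∈C , x∈C , x≢v ∘ ≡.sym , nonadjacent)))

  ¬difficult⇒degIn≤2e : ¬ Difficult G Δ part C →
    ∀ u → inAC G Δ part C u ≡ false → degIn G Δ part C u ≤ 2 * eAC G Δ part C
  ¬difficult⇒degIn≤2e ¬difficult u u∉C = <⇒≤ (≰⇒> (λ intrusive →
    ¬difficult (¬easy , u , ¬easy , (λ u∈C → case ≡.trans (≡.sym u∉C) u∈C of λ ()) , intrusive)))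

mainTheorem5 : ∀ {n t : ℕ} (G : Graph n) (Δ : ℕ) → MaxDegree G Δ →
    (part : Fin n → Maybe (Fin t)) → IsACD G Δ part 172 →
    (s : Fin t → Fin n) → SpecialSelection G Δ part s →
    ∀ (C : Fin t) → Ordinary G Δ part s C →
    ∀ (v : Fin n) → _∈AC_ G Δ part v C →
      (eAC G Δ part C * (Δ ∸ 3 * eAC G Δ part C) ≤ nonEdgesNbhd G v)
      × (∀ (a b : ℕ) → 0 < a → 0 < b → Small G Δ part a b C →
           b * (Δ * Δ) ≤ 2 * a * nonEdgesNbhd G v)
mainTheorem5 G Δ maxDeg part acd s _ C (¬nice , ¬difficult) v v∈C = nonEdges≥ , smallCase
  where
  ¬easy : ¬ Easy G Δ part C
  ¬easy = ¬nice ∘ inj₁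

  nonEdges≥ : eAC G Δ part C * (Δ ∸ 3 * eAC G Δ part C) ≤ nonEdgesNbhd G v
  nonEdges≥ = nonEdgesNbhd-≥-clique G v (inAC G Δ part C) v∈C
    (¬easy⇒clique G Δ part C ¬easy v∈C) Δ (¬easy⇒deg≡Δ G Δ part C ¬easy maxDeg v∈C)
    (¬difficult⇒degIn≤2e G Δ part C ¬easy ¬difficult)

  smallCase : ∀ a b → 0 < a → 0 < b → Small G Δ part a b C → b * (Δ * Δ) ≤ 2 * a * nonEdgesNbhd G v
  -- For k = 172 the size bound of IsACD reads 687 Δ ≤ 688 |C|.
  smallCase a b _ _ small = small⇒b*Δ²≤2*a*N a b Δ (size G Δ part C) _ small
    (≤-trans (*-monoˡ-≤ (Δ ∸ size G Δ part C) (m≤m+n 11 676))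
             (m*n≤[1+m]*o⇒m*[n∸o]≤o 687 Δ _ (proj₁ (acd C))))
    nonEdges≥
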